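{- Let $G_0$ be a connected bipartite $(p,q)$-graph admitting an odd-edge felicitous-difference total coloring $h_0$. Then for every positive integer $n$ there is a sequence $G_0,G_1,\dots,G_n$ of connected bipartite graphs such that for each $k\in[1,n]$ the graph $G_k$ is obtained from $G_{k-1}$ by adding $a_k\geq 1$ leaves and admits an odd-edge felicitous-difference total coloring $h_k$, and moreover $h_i(V(G_i))\cap h_j(V(G_j))\neq\emptyset$ for all $i,j\in[0,n]$.
   Context: A $(p,q)$-graph has $p$ vertices and $q$ edges; $[a,b]=\{a,\dots,b\}$ and $[1,2q-1]^o$ denotes the set of odd integers in $[1,2q-1]$; $h(S)=\{h(s):s\in S\}$. Adding a leaf to a graph $H$ means adding a new vertex $w$ and an edge $xw$ for some $x\in V(H)$. For a bipartite $(p,q)$-graph $H$ with $q\ge1$, an odd-edge felicitous-difference total coloring is a map $h:V(H)\cup E(H)\to[0,2q-1]$ (vertex colors need not be distinct) such that $h(E(H))=[1,2q-1]^o$ and there is a non-negative integer $k$ with $|h(u)+h(v)-h(uv)|=k$ for every edge $uv\in E(H)$. -}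

module Defs where

open import Data.Nat using (ℕ; zero; suc; _+_; _*_; _∸_; _≤_; ∣_-_∣)
open import Data.Fin using (Fin; zero; suc)
open import Data.Bool using (Bool)
open import Data.Product using (Σ; ∃; _×_; _,_; proj₁; proj₂)
open import Data.Sum using (_⊎_)
open import Relation.Binary.PropositionalEquality using (_≡_; _≢_)

-- A finite graph with p vertices (Fin p) and q edges (Fin q);
-- edge e joins the two vertices in  ends e  (unordered reading).
record Graph : Set where
  constructor mkGraph
  field
    p    : ℕ
    q    : ℕ
    ends : Fin q → Fin p × Fin p
open Graph public

Joins : (G : Graph) → Fin (q G) → Fin (p G) → Fin (p G) → Set
Joins G e u v = (ends G e ≡ (u , v)) ⊎ (ends G e ≡ (v , u))

Simple : Graph → Set
Simple G = (∀ e → proj₁ (ends G e) ≢ proj₂ (ends G e))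
         × (∀ e e′ → Joins G e′ (proj₁ (ends G e)) (proj₂ (ends G e)) → e ≡ e′)

Adj : (G : Graph) → Fin (p G) → Fin (p G) → Set
Adj G u v = ∃ λ e → Joins G e u v

data Walk (G : Graph) : Fin (p G) → Fin (p G) → Set where
  here : ∀ {u} → Walk G u u
  step : ∀ {u v w} → Adj G u v → Walk G v w → Walk G u w

Connected : Graph → Set
Connected G = ∀ u v → Walk G u v

Bipartite : Graph → Set
Bipartite G = ∃ λ (c : Fin (p G) → Bool) →
  ∀ e → c (proj₁ (ends G e)) ≢ c (proj₂ (ends G e))

Odd : ℕ → Set
Odd n = ∃ λ m → n ≡ suc (2 * m)

-- Odd-edge felicitous-difference total coloring h, given by its vertex part f
-- and its edge part g, both into [0, 2q-1].
IsOEFDTC : (G : Graph) → (Fin (p G) → ℕ) → (Fin (q G) → ℕ) → Set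
IsOEFDTC G f g =
  1 ≤ q G
  × (∀ v → f v ≤ 2 * q G ∸ 1)
  × (∀ e → g e ≤ 2 * q G ∸ 1)
  × (∀ e → Odd (g e))
  × (∀ m → Odd m → 1 ≤ m → m ≤ 2 * q G ∸ 1 → ∃ λ e → g e ≡ m)
  × (∃ λ k → ∀ e → ∣ f (proj₁ (ends G e)) + f (proj₂ (ends G e)) - g e ∣ ≡ k)

AdmitsOEFDTC : Graph → Set
AdmitsOEFDTC G = ∃ λ f → ∃ λ g → IsOEFDTC G f g

addLeaf : (G : Graph) → Fin (p G) → Graph
addLeaf (mkGraph p q ends) x = mkGraph (suc p) (suc q) ends′
  where
  ends′ : Fin (suc q) → Fin (suc p) × Fin (suc p)
  ends′ zero = (suc x , zero)
  ends′ (suc e) = (suc (proj₁ (ends e)) , suc (proj₂ (ends e)))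

data AddLeaves : ℕ → Graph → Graph → Set where
  done : ∀ {G} → AddLeaves 0 G G
  more : ∀ {a G H} (x : Fin (p G)) → AddLeaves a (addLeaf G x) H → AddLeaves (suc a) G H

_◁_ : Graph → (ℕ → Graph) → ℕ → Graph
(G0 ◁ Gs) zero    = G0
(G0 ◁ Gs) (suc k) = Gs k

{-# OPTIONS --safe #-}
module Submission where

open import Defs
open import Data.Nat using (ℕ; zero; suc; _≤_; _<_; _+_; _*_; _∸_; ∣_-_∣; _⊔_; z≤n; s≤s; _≤?_)
open import Data.Nat.Properties
open import Data.Fin using (Fin; zero; suc)
open import Data.Bool using (Bool; true; false; not)
open import Data.Bool.Properties using (not-injective; not-¬; ¬-not)
open import Data.Product using (Σ; ∃; _×_; _,_; proj₁; proj₂)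
open import Data.Sum using (inj₁; inj₂)
open import Function using (_∘_)
open import Relation.Nullary using (yes; no; contradiction)
open import Relation.Binary.PropositionalEquality
  using (_≡_; _≢_; refl; sym; trans; cong; subst; module ≡-Reasoning)

-- Add one leaf w at a time, always at the same anchor vertex x.  The new edge xw
-- gets either colour 2q+1, the next odd number, or colour 1 after all edge colours
-- are raised by 2; the latter is compensated by raising by 2 the colours of the
-- colour class of x in a fixed bipartition.  Either way the colour of w is forced
-- by |h(x) + h(w) − h(xw)| = k, and it lies in [0, 2q+1] when k ≤ h(x) in the
-- first case and when h(x) < k ≤ h(x) + 2q + 2 in the second.  This bound holds
-- initially and is preserved, and vertices outside the class of x never change
-- colour, so a fixed such vertex has the same colour in every graph.

<⇒≤∸1 : ∀ {m n} → m < n → m ≤ n ∸ 1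
<⇒≤∸1 (s≤s m≤n) = m≤n

≤2*∸1⇒<2* : ∀ {m q} → 1 ≤ q → m ≤ 2 * q ∸ 1 → m < 2 * q
≤2*∸1⇒<2* {q = suc _} _ m≤ = s≤s m≤

<2*⇒<2*suc : ∀ {m} q → m < 2 * q → 2 + m < 2 * suc q
<2*⇒<2*suc {m} q m< = subst (2 + m <_) (sym (*-suc 2 q)) (s≤s (s≤s m<))

≤1+2*⇒<2*suc : ∀ {m} q → m ≤ suc (2 * q) → m < 2 * suc q
≤1+2*⇒<2*suc {m} q m≤ = subst (m <_) (sym (*-suc 2 q)) (s≤s m≤)

1+2*<2*⇒< : ∀ m q → suc (2 * m) < 2 * q → m < q
1+2*<2*⇒< m q lt = *-cancelˡ-< 2 m q (<-trans (n<1+n _) lt)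

<⇒1+2*<2* : ∀ m q → m < q → suc (2 * m) < 2 * q
<⇒1+2*<2* m q lt = subst (_≤ 2 * q) (*-suc 2 m) (*-monoʳ-≤ 2 lt)

2+odd : ∀ m → 2 + suc (2 * m) ≡ suc (2 * suc m)
2+odd m = cong suc (sym (*-suc 2 m))

raise : Bool → ℕ → ℕ
raise true  n = 2 + n
raise false n = n

raise≤ : ∀ b n → raise b n ≤ 2 + n
raise≤ true  n = ≤-refl
raise≤ false n = m≤n+m n 2

raise-∣-∣ : ∀ {a b} → a ≢ b → ∀ m n o → ∣ raise a m + raise b n - (2 + o) ∣ ≡ ∣ m + n - o ∣
raise-∣-∣ {true}  {true}  a≢b = contradiction refl a≢b
raise-∣-∣ {false} {false} a≢b = contradiction refl a≢b
raise-∣-∣ {true}  {false} _ m n o = refl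
raise-∣-∣ {false} {true}  _ m n o rewrite +-suc m (suc n) | +-suc m n = refl

_++ᵂ_ : ∀ {G u v w} → Walk G u v → Walk G v w → Walk G u w
here       ++ᵂ w = w
step uv vw ++ᵂ w = step uv (vw ++ᵂ w)

module _ (G : Graph) (x : Fin (p G)) where

  private
    G⁺ = addLeaf G x

  addLeaf-adj : ∀ {u v} → Adj G u v → Adj G⁺ (suc u) (suc v)
  addLeaf-adj (e , inj₁ eq) = suc e , inj₁ (cong (λ (a , b) → suc a , suc b) eq)
  addLeaf-adj (e , inj₂ eq) = suc e , inj₂ (cong (λ (a , b) → suc a , suc b) eq)

  addLeaf-walk : ∀ {u v} → Walk G u v → Walk G⁺ (suc u) (suc v)
  addLeaf-walk here         = here
  addLeaf-walk (step uv vw) = step (addLeaf-adj uv) (addLeaf-walk vw)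

  addLeaf-connected : Connected G → Connected G⁺
  addLeaf-connected conn zero    zero    = here
  addLeaf-connected conn zero    (suc v) = step (zero , inj₂ refl) (addLeaf-walk (conn x v))
  addLeaf-connected conn (suc u) zero    = addLeaf-walk (conn u x) ++ᵂ step (zero , inj₁ refl) here
  addLeaf-connected conn (suc u) (suc v) = addLeaf-walk (conn u v)

Proper : (G : Graph) → (Fin (p G) → Bool) → Set
Proper G c = ∀ e → c (proj₁ (ends G e)) ≢ c (proj₂ (ends G e))

leafSides : ∀ {G} → (Fin (p G) → Bool) → Fin (p G) → Fin (suc (p G)) → Bool
leafSides c x zero    = not (c x)
leafSides c x (suc y) = c y

addLeaf-proper : ∀ {G c} x → Proper G c → Proper (addLeaf G x) (leafSides {G} c x)
addLeaf-proper {c = c} x proper zero = not-¬ {c x} refl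
addLeaf-proper x proper (suc e) = proper e

orient : ∀ {G c} → Proper G c → ∀ u → ∃ λ c′ → Proper G c′ × c′ u ≡ true
orient {c = c} proper u with c u in cu
... | true  = c , proper , cu
... | false = not ∘ c , (λ e → proper e ∘ not-injective) , cong not cu

-- IsOEFDTC with strict bounds and surjectivity onto the odd colours indexed by
-- m < q, which avoids the truncated 2q ∸ 1.
record Colouring (G : Graph) : Set where
  field
    f          : Fin (p G) → ℕ
    g          : Fin (q G) → ℕ
    k          : ℕ
    nonempty   : 1 ≤ q G
    f<         : ∀ v → f v < 2 * q G
    g<         : ∀ e → g e < 2 * q G
    g-odd      : ∀ e → Odd (g e)
    g-onto     : ∀ m → m < q G → ∃ λ e → g e ≡ suc (2 * m)
    felicitous : ∀ e → ∣ f (proj₁ (ends G e)) + f (proj₂ (ends G e)) - g e ∣ ≡ k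

fromIsOEFDTC : ∀ {G f g} → IsOEFDTC G f g → Colouring G
fromIsOEFDTC {G} {f} {g} (nonempty , f≤ , g≤ , g-odd , g-onto , k , felicitous) = record
  { f          = f
  ; g          = g
  ; k          = k
  ; nonempty   = nonempty
  ; f<         = ≤2*∸1⇒<2* nonempty ∘ f≤
  ; g<         = ≤2*∸1⇒<2* nonempty ∘ g≤
  ; g-odd      = g-odd
  ; g-onto     = λ m m<q → g-onto _ (m , refl) (s≤s z≤n)
                              (<⇒≤∸1 (<⇒1+2*<2* m (q G) m<q))
  ; felicitous = felicitous
  }

toIsOEFDTC : ∀ {G} (χ : Colouring G) → IsOEFDTC G (Colouring.f χ) (Colouring.g χ)
toIsOEFDTC {G} χ = nonempty , <⇒≤∸1 ∘ f< , <⇒≤∸1 ∘ g< , g-odd , onto , k , felicitous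
  where
  open Colouring χ
  onto : ∀ n → Odd n → 1 ≤ n → n ≤ 2 * q G ∸ 1 → ∃ λ e → g e ≡ n
  onto _ (m , refl) _ n≤ = g-onto m (1+2*<2*⇒< m (q G) (≤2*∸1⇒<2* nonempty n≤))

module _ {G : Graph} (χ : Colouring G) (x : Fin (p G)) where
  open Colouring χ

  private
    top : ℕ
    top = suc (2 * q G)

    2*q<2*suc : 2 * q G < 2 * suc (q G)
    2*q<2*suc = *-monoʳ-< 2 (n<1+n (q G))

  topLeafColouring : k ≤ f x → Colouring (addLeaf G x)
  topLeafColouring k≤fx = record
    { f = f′ ; g = g′ ; k = k ; nonempty = s≤s z≤n ; f< = f′< ; g< = g′<
    ; g-odd = g′-odd ; g-onto = g′-onto ; felicitous = felicitous′ }
    where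
    f′ : Fin (suc (p G)) → ℕ
    f′ zero    = top + k ∸ f x
    f′ (suc y) = f y

    g′ : Fin (suc (q G)) → ℕ
    g′ zero    = top
    g′ (suc e) = g e

    fx≤top+k : f x ≤ top + k
    fx≤top+k = m≤n⇒m≤n+o k (<⇒≤ (<-trans (f< x) (n<1+n _)))

    f′< : ∀ v → f′ v < 2 * suc (q G)
    f′< zero    = ≤1+2*⇒<2*suc (q G) (m≤n+o⇒m∸n≤o (top + k) (f x)
                    (≤-trans (+-monoʳ-≤ top k≤fx) (≤-reflexive (+-comm top (f x)))))
    f′< (suc y) = <-trans (f< y) 2*q<2*suc

    g′< : ∀ e → g′ e < 2 * suc (q G)
    g′< zero    = ≤1+2*⇒<2*suc (q G) ≤-refl
    g′< (suc e) = <-trans (g< e) 2*q<2*suc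

    g′-odd : ∀ e → Odd (g′ e)
    g′-odd zero    = q G , refl
    g′-odd (suc e) = g-odd e

    g′-onto : ∀ m → m < suc (q G) → ∃ λ e → g′ e ≡ suc (2 * m)
    g′-onto m m≤q with m<1+n⇒m<n∨m≡n m≤q
    ... | inj₁ m<q  = let (e , ge) = g-onto m m<q in suc e , ge
    ... | inj₂ refl = zero , refl

    felicitous′ : ∀ e → ∣ f′ (proj₁ (ends (addLeaf G x) e)) + f′ (proj₂ (ends (addLeaf G x) e)) - g′ e ∣ ≡ k
    felicitous′ zero = begin
      ∣ f x + (top + k ∸ f x) - top ∣ ≡⟨ cong ∣_- top ∣ (m+[n∸m]≡n fx≤top+k) ⟩
      ∣ top + k - top ∣               ≡⟨ ∣-∣-comm (top + k) top ⟩
      ∣ top - top + k ∣               ≡⟨ ∣m-m+n∣≡n top k ⟩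
      k                               ∎
      where open ≡-Reasoning
    felicitous′ (suc e) = felicitous e

  bottomLeafColouring : (c : Fin (p G) → Bool) → Proper G c → c x ≡ true →
                        f x < k → k ≤ f x + (2 + 2 * q G) → Colouring (addLeaf G x)
  bottomLeafColouring c proper cx fx<k slack = record
    { f = f′ ; g = g′ ; k = k ; nonempty = s≤s z≤n ; f< = f′< ; g< = g′<
    ; g-odd = g′-odd ; g-onto = g′-onto ; felicitous = felicitous′ }
    where
    f′ : Fin (suc (p G)) → ℕ
    f′ zero    = k ∸ suc (f x)
    f′ (suc y) = raise (c y) (f y)

    g′ : Fin (suc (q G)) → ℕ
    g′ zero    = 1
    g′ (suc e) = 2 + g e

    f′< : ∀ v → f′ v < 2 * suc (q G)
    f′< zero    = ≤1+2*⇒<2*suc (q G) (m≤n+o⇒m∸n≤o k (suc (f x))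
                    (subst (k ≤_) (+-suc (f x) top) slack))
    f′< (suc y) = ≤-<-trans (raise≤ (c y) (f y)) (<2*⇒<2*suc (q G) (f< y))

    g′< : ∀ e → g′ e < 2 * suc (q G)
    g′< zero    = ≤1+2*⇒<2*suc (q G) (s≤s z≤n)
    g′< (suc e) = <2*⇒<2*suc (q G) (g< e)

    g′-odd : ∀ e → Odd (g′ e)
    g′-odd zero    = 0 , refl
    g′-odd (suc e) = let (m , ge) = g-odd e in suc m , trans (cong (2 +_) ge) (2+odd m)

    g′-onto : ∀ m → m < suc (q G) → ∃ λ e → g′ e ≡ suc (2 * m)
    g′-onto zero    _         = zero , refl
    g′-onto (suc m) (s≤s m<q) = let (e , ge) = g-onto m m<q in suc e , trans (cong (2 +_) ge) (2+odd m)

    felicitous′ : ∀ e → ∣ f′ (proj₁ (ends (addLeaf G x) e)) + f′ (proj₂ (ends (addLeaf G x) e)) - g′ e ∣ ≡ k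
    felicitous′ zero rewrite cx = m+[n∸m]≡n fx<k
    felicitous′ (suc e) =
      let (u , v) = ends G e in
      trans (raise-∣-∣ (proper e) (f u) (f v) (g e)) (felicitous e)

record Stage (C : ℕ) (G : Graph) : Set where
  field
    colouring    : Colouring G
    side         : Fin (p G) → Bool
    proper       : Proper G side
    connected    : Connected G
    anchor       : Fin (p G)
    anchor-side  : side anchor ≡ true
    witness      : Fin (p G)
    witness-side : side witness ≡ false
  open Colouring colouring public
  field
    slack          : k ≤ f anchor + (2 + 2 * q G)
    witness-colour : f witness ≡ C

module _ {C : ℕ} {G : Graph} (S : Stage C G) where
  open Stage S

  private
    G⁺ = addLeaf G anchor

    extend : (χ : Colouring G⁺) → Colouring.k χ ≡ k →
             f anchor ≤ Colouring.f χ (suc anchor) →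
             Colouring.f χ (suc witness) ≡ f witness → Stage C G⁺
    extend χ refl fx≤ fb≡ = record
      { colouring      = χ
      ; side           = leafSides side anchor
      ; proper         = addLeaf-proper anchor proper
      ; connected      = addLeaf-connected G anchor connected
      ; anchor         = suc anchor
      ; anchor-side    = anchor-side
      ; witness        = suc witness
      ; witness-side   = witness-side
      ; slack          = ≤-trans slack (+-mono-≤ fx≤ (s≤s (s≤s (*-monoʳ-≤ 2 (n≤1+n (q G))))))
      ; witness-colour = trans fb≡ witness-colour
      }

  grow : Stage C (addLeaf G anchor)
  grow with k ≤? f anchor
  ... | yes k≤fx = extend (topLeafColouring colouring anchor k≤fx) refl ≤-refl refl
  ... | no  k≰fx = extend (bottomLeafColouring colouring anchor side proper anchor-side (≰⇒> k≰fx) slack)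
                     refl (subst (λ b → f anchor ≤ raise b (f anchor)) (sym anchor-side) (m≤n+m _ 2))
                     (cong (λ b → raise b (f witness)) witness-side)

initialStage : ∀ {G f g} → Connected G → Bipartite G → IsOEFDTC G f g → ∃ λ C → Stage C G
initialStage {G} connected (c , proper) oefdtc = f v , record
  { colouring      = χ
  ; side           = c′
  ; proper         = proper′
  ; connected      = connected
  ; anchor         = u
  ; anchor-side    = c′u
  ; witness        = v
  ; witness-side   = trans (¬-not (proper′ e₀ ∘ sym)) (cong not c′u)
  ; slack          = slack
  ; witness-colour = refl
  }
  where
  χ = fromIsOEFDTC oefdtc
  open Colouring χ

  edge : ∀ {n} → 1 ≤ n → Fin n
  edge {suc _} _ = zero

  e₀ = edge nonempty
  u  = proj₁ (ends G e₀)
  v  = proj₂ (ends G e₀)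

  oriented = orient {G} {c} proper u
  c′      = proj₁ oriented
  proper′ = proj₁ (proj₂ oriented)
  c′u     = proj₂ (proj₂ oriented)

  <2*⇒≤2+2* : ∀ {m} → m < 2 * q G → m ≤ 2 + 2 * q G
  <2*⇒≤2+2* m< = ≤-trans (<⇒≤ m<) (m≤n+m _ 2)

  slack : k ≤ f u + (2 + 2 * q G)
  slack = begin
    k                              ≡⟨ felicitous e₀ ⟨
    ∣ f u + f v - g e₀ ∣           ≤⟨ ∣m-n∣≤m⊔n (f u + f v) (g e₀) ⟩
    (f u + f v) ⊔ g e₀             ≤⟨ ⊔-lub (+-monoʳ-≤ (f u) (<2*⇒≤2+2* (f< v)))
                                            (≤-trans (<2*⇒≤2+2* (g< e₀)) (m≤n+m _ (f u))) ⟩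
    f u + (2 + 2 * q G)            ∎
    where open ≤-Reasoning

mainTheorem7 : (G0 : Graph) → Simple G0 → Connected G0 → Bipartite G0 →
    (f0 : Fin (p G0) → ℕ) → (g0 : Fin (q G0) → ℕ) → IsOEFDTC G0 f0 g0 →
    (n : ℕ) → 1 ≤ n →
    ∃ λ (Gs : ℕ → Graph) →
      (∀ i → i ≤ n → Connected ((G0 ◁ Gs) i) × Bipartite ((G0 ◁ Gs) i))
      × (∀ k → k < n → ∃ λ a → 1 ≤ a × AddLeaves a ((G0 ◁ Gs) k) ((G0 ◁ Gs) (suc k)))
      × (∃ λ (f : (i : ℕ) → Fin (p ((G0 ◁ Gs) i)) → ℕ) →
         ∃ λ (g : (i : ℕ) → Fin (q ((G0 ◁ Gs) i)) → ℕ) →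
           (∀ v → f zero v ≡ f0 v) × (∀ e → g zero e ≡ g0 e)
           × (∀ i → i ≤ n → IsOEFDTC ((G0 ◁ Gs) i) (f i) (g i))
           × (∀ i j → i ≤ n → j ≤ n →
                ∃ λ u → ∃ λ v → f i u ≡ f j v))
mainTheorem7 G0 _ connected₀ bipartite₀ f0 g0 oefdtc n _ =
  Gs
  , (λ i _ → connected (stage i) , side (stage i) , proper (stage i))
  , (λ i _ → 1 , s≤s z≤n , leafStep i)
  , (λ i → f (stage i)) , (λ i → g (stage i)) , (λ _ → refl) , (λ _ → refl)
  , (λ i _ → toIsOEFDTC (colouring (stage i)))
  , λ i j _ _ → witness (stage i) , witness (stage j)
                , trans (witness-colour (stage i)) (sym (witness-colour (stage j)))
  where
  open Stage

  C  = proj₁ (initialStage connected₀ bipartite₀ oefdtc)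
  S₀ = proj₂ (initialStage connected₀ bipartite₀ oefdtc)

  growth : ℕ → Σ Graph (Stage C)
  growth zero    = G0 , S₀
  growth (suc i) = let (G , S) = growth i in addLeaf G (anchor S) , grow S

  Gs : ℕ → Graph
  Gs i = proj₁ (growth (suc i))

  stage : ∀ i → Stage C ((G0 ◁ Gs) i)
  stage zero    = S₀
  stage (suc i) = proj₂ (growth (suc i))

  leafStep : ∀ i → AddLeaves 1 ((G0 ◁ Gs) i) ((G0 ◁ Gs) (suc i))
  leafStep zero    = more (anchor S₀) done
  leafStep (suc i) = more (anchor (stage (suc i))) done
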